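{- Let $C$ be a monotonic constraint over integer variables $x_{i,j}$ ($1\le i\le n$, $1\le j\le m_i$), and let $P$ be a consistent propagator for $C$. Define the constraint $C'$ over integer variables $x_1,\dots,x_n$ by $C'(x_1,\dots,x_n)=C(x_1,\dots,x_1,x_2,\dots,x_2,\dots,x_n,\dots,x_n)$ (each $x_i$ substituted for all of $x_{i,1},\dots,x_{i,m_i}$), and define $P'$ as the procedure that, given domains $E(x_1),\dots,E(x_n)$, runs $P$ on the domains $E'(x_{i,j})=E(x_i)$ and reports a conflict iff $P$ does. Then $P'$ is a consistent propagator for $C'$: for every choice of domains $E$, $P'$ reports a conflict if and only if there is no assignment with $x_i\in E(x_i)$ for all $i$ satisfying $C'$.
   Context: A domain assigns to each variable a finite set of integers. A constraint $C$ over integer variables is monotonic if whenever an integer assignment $v$ satisfies $C$ and $w\le v$ componentwise (with $w$ in the variables' domains), then $w$ satisfies $C$. A propagator $P$ for $C$ is consistent if, given domains for the variables of $C$, it reports a conflict (returns a domain with some empty set) if and only if no assignment taking each variable to a value of its domain satisfies $C$. -}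

module Defs where

open import Data.Nat using (ℕ)
open import Data.Integer using (ℤ; _≤_)
open import Data.Fin using (Fin)
open import Data.Fin.Properties using (any?)
open import Data.List using (List; []; null)
open import Data.List.Membership.Propositional using (_∈_)
open import Data.Product using (Σ; _×_; _,_; ∃)
open import Data.Bool using (Bool; if_then_else_; T)
open import Relation.Nullary using (¬_; does)
open import Relation.Nullary.Decidable using (T?)
open import Relation.Binary.PropositionalEquality using (_≡_)
open import Function.Bundles using (_⇔_)

Assignment : Set → Set
Assignment V = V → ℤ

Domain : Set → Set
Domain V = V → List ℤ

-- Initial ("the variables'") domains: an arbitrary set of integers per variable.
InitDomain : Set → Set₁
InitDomain V = V → ℤ → Set

Constraint : Set → Set₁
Constraint V = Assignment V → Set

Propagator : Set → Set
Propagator V = Domain V → Domain V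

InInit : {V : Set} → InitDomain V → Assignment V → Set
InInit D v = ∀ x → D x (v x)

_⊆ᴰ_ : {V : Set} → Domain V → InitDomain V → Set
E ⊆ᴰ D = ∀ x z → z ∈ E x → D x z

Monotonic : {V : Set} → InitDomain V → Constraint V → Set
Monotonic {V} D C =
  (v w : Assignment V) → InInit D v → InInit D w →
  (∀ x → w x ≤ v x) → C v → C w

Conflict : {V : Set} → Domain V → Set
Conflict {V} E = Σ V (λ x → E x ≡ [])

Satisfiable : {V : Set} → Domain V → Constraint V → Set
Satisfiable {V} E C = Σ (Assignment V) (λ v → (∀ x → v x ∈ E x) × C v)

Consistent : {V : Set} → InitDomain V → Constraint V → Propagator V → Set
Consistent D C P = ∀ E → E ⊆ᴰ D → (Conflict (P E) ⇔ (¬ Satisfiable E C))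

Var₂ : (n : ℕ) → (Fin n → ℕ) → Set
Var₂ n m = Σ (Fin n) (λ i → Fin (m i))

spread : {A : Set} {n : ℕ} {m : Fin n → ℕ} → (Fin n → A) → Var₂ n m → A
spread f (i , j) = f i

mergeConstraint : {n : ℕ} {m : Fin n → ℕ} → Constraint (Var₂ n m) → Constraint (Fin n)
mergeConstraint C v = C (spread v)

mergeInit : {n : ℕ} {m : Fin n → ℕ} → InitDomain (Var₂ n m) → InitDomain (Fin n)
mergeInit {m = m} D i z = (j : Fin (m i)) → D (i , j) z

hasEmpty : {n : ℕ} {m : Fin n → ℕ} → Domain (Var₂ n m) → Bool
hasEmpty {n} {m} E = does (any? (λ i → any? (λ j → T? (null (E (i , j))))))

-- P': run P on E'(x_{i,j}) = E(x_i); report a conflict (all sets emptied) iff P does,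
-- otherwise return E unchanged.
mergePropagator : {n : ℕ} {m : Fin n → ℕ} → Propagator (Var₂ n m) → Propagator (Fin n)
mergePropagator P E i = if hasEmpty (P (spread E)) then [] else E i

{-# OPTIONS --safe #-}
module Submission where

open import Defs
open import Data.Nat using (ℕ; _≥_)
open import Data.Fin using (Fin; fromℕ<)
open import Data.Fin.Properties using (any?)
open import Data.Integer using (ℤ; _≤_)
open import Data.Integer.Properties using (≤-totalOrder)
open import Data.List using (List; []; null; allFin)
open import Data.List.Extrema ≤-totalOrder using (argmin; f[argmin]≤f[xs])
open import Data.List.Membership.Propositional using (_∈_)
open import Data.List.Membership.Propositional.Properties using (∈-allFin)
open import Data.List.Relation.Unary.All using (lookup)
open import Data.List.Relation.Unary.Any.Properties using (¬Any[])
open import Data.Product using (∃; _,_; proj₁; proj₂)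
open import Data.Sum using (_⊎_; inj₁; inj₂; [_,_])
open import Data.Bool using (T)
open import Relation.Nullary using (¬_; yes; no; contradiction)
open import Relation.Nullary.Decidable using (T?)
open import Relation.Binary.PropositionalEquality using (_≡_; refl; subst)
open import Function.Base using (_∘_; id)
open import Function.Bundles using (_⇔_; mk⇔; Equivalence)

minimiser : ∀ {k} (f : Fin k → ℤ) → Fin k → ∃ λ j → ∀ j′ → f j ≤ f j′
minimiser {k} f j₀ = j , λ j′ → lookup (f[argmin]≤f[xs] j₀ (allFin k)) (∈-allFin j′)
  where j = argmin f j₀ (allFin k)

null⇒≡[] : {A : Set} (xs : List A) → T (null xs) → xs ≡ []
null⇒≡[] [] _ = refl

≡[]⇒null : {A : Set} {xs : List A} → xs ≡ [] → T (null xs)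
≡[]⇒null refl = _

conflict⇒unsatisfiable : ∀ {V} {E : Domain V} {C : Constraint V} → Conflict E → ¬ Satisfiable E C
conflict⇒unsatisfiable (x , Ex≡[]) (v , v∈E , _) = ¬Any[] (subst (v x ∈_) Ex≡[] (v∈E x))

module _ {n : ℕ} {m : Fin n → ℕ} where

  mergePropagator-conflict : (P : Propagator (Var₂ n m)) (E : Domain (Fin n)) →
    Conflict (mergePropagator P E) ⇔ (Conflict (P (spread E)) ⊎ Conflict E)
  mergePropagator-conflict P E with any? (λ i → any? (λ j → T? (null (P (spread E) (i , j)))))
  ... | yes (i , j , empty) =
    mk⇔ (λ _ → inj₁ ((i , j) , null⇒≡[] _ empty)) (λ _ → i , refl)
  ... | no noEmpty =
    mk⇔ inj₂ [ (λ { ((i , j) , eq) → contradiction (i , j , ≡[]⇒null eq) noEmpty }) , id ]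

  spread-⊆ᴰ : {E : Domain (Fin n)} {D : InitDomain (Var₂ n m)} →
    E ⊆ᴰ mergeInit D → spread E ⊆ᴰ D
  spread-⊆ᴰ E⊆D (i , j) z z∈Ei = E⊆D i z z∈Ei j

  satisfiable-spread : {E : Domain (Fin n)} {C : Constraint (Var₂ n m)} →
    Satisfiable E (mergeConstraint C) → Satisfiable (spread E) C
  satisfiable-spread (v , v∈E , Cv) = spread v , (λ { (i , _) → v∈E i }) , Cv

  -- Collapsing each block x_{i,·} to its least value stays inside E and, by monotonicity, satisfies C.
  satisfiable-merge : (∀ i → m i ≥ 1) →
    {D : InitDomain (Var₂ n m)} {C : Constraint (Var₂ n m)} → Monotonic D C →
    {E : Domain (Fin n)} → E ⊆ᴰ mergeInit D →
    Satisfiable (spread E) C → Satisfiable E (mergeConstraint C)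
  satisfiable-merge m≥1 {D} mono {E} E⊆D (w , w∈E , Cw) =
    v , v∈E , mono w (spread v) wD vD v≤w Cw
    where
    least : ∀ i → ∃ λ j → ∀ j′ → w (i , j) ≤ w (i , j′)
    least i = minimiser (λ j → w (i , j)) (fromℕ< (m≥1 i))

    v : Fin n → ℤ
    v i = w (i , proj₁ (least i))

    v∈E : ∀ i → v i ∈ E i
    v∈E i = w∈E (i , proj₁ (least i))

    wD : InInit D w
    wD x = spread-⊆ᴰ E⊆D x (w x) (w∈E x)

    vD : InInit D (spread v)
    vD (i , j) = E⊆D i (v i) (v∈E i) j

    v≤w : ∀ x → spread v x ≤ w x
    v≤w (i , j) = proj₂ (least i) j

theorem7 : (n : ℕ) (m : Fin n → ℕ) → (∀ i → m i ≥ 1) →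
    (D : InitDomain (Var₂ n m)) (C : Constraint (Var₂ n m)) (P : Propagator (Var₂ n m)) →
    Monotonic D C → Consistent D C P →
    Consistent (mergeInit D) (mergeConstraint C) (mergePropagator P)
theorem7 n m m≥1 D C P mono cons E E⊆D = mk⇔ conflict⇒unsat unsat⇒conflict
  where
  consistent-on-spread : Conflict (P (spread E)) ⇔ (¬ Satisfiable (spread E) C)
  consistent-on-spread = cons (spread E) (spread-⊆ᴰ E⊆D)

  conflict⇒unsat : Conflict (mergePropagator P E) → ¬ Satisfiable E (mergeConstraint C)
  conflict⇒unsat c = [ (λ cP → Equivalence.to consistent-on-spread cP ∘ satisfiable-spread)
                     , conflict⇒unsatisfiable ]
                     (Equivalence.to (mergePropagator-conflict P E) c)

  unsat⇒conflict : ¬ Satisfiable E (mergeConstraint C) → Conflict (mergePropagator P E)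
  unsat⇒conflict unsat = Equivalence.from (mergePropagator-conflict P E)
    (inj₁ (Equivalence.from consistent-on-spread (unsat ∘ satisfiable-merge m≥1 mono E⊆D)))
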